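{- Let $n \geq 1$. For every function $f : \{0,1\}^n \times \{0,1\}^n \to \{0,1\}$, we have $\log_2 \chi^{\mathrm{geom}}(f) \leq C^{\mathrm{comp}}(f)$.
   Context: Order $\{0,1\}^n$ lexicographically, i.e. compare strings as binary representations of integers in $\{0,\dots,2^n-1\}$ with the first bit most significant; write $[a,b] = \{z \in \{0,1\}^n : a \leq z \leq b\}$. A geometric rectangle is a set of the form $[a_{\min}, a_{\max}] \times [b_{\min}, b_{\max}] \subseteq \{0,1\}^n \times \{0,1\}^n$. It is $f$-monochromatic if $f$ is constant on it. $\chi^{\mathrm{geom}}(f)$ is the minimum number of pairwise disjoint $f$-monochromatic geometric rectangles whose union is $\{0,1\}^n \times \{0,1\}^n$. For $z \in \{0,1\}^n$, the comparison function $\theta_z : \{0,1\}^n \to \{0,1\}$ is defined by $\theta_z(y) = 1$ if and only if $y \geq z$. A comparison protocol is a rooted tree in which every internal vertex has exactly two children (via outgoing edges labeled $0$ and $1$), is owned either by Alice or by Bob, and is labeled by a function which is either some $\theta_z$ ($z \in \{0,1\}^n$) or the constant $0$ function; leaves are labeled by outputs in $\{0,1\}$. On input $(x,y)$ (Alice holds $x$, Bob holds $y$), one starts at the root; at an internal vertex owned by Alice (resp. Bob) its function is evaluated on $x$ (resp. $y$) and the edge labeled by the result is followed; the output is the label of the leaf reached. The protocol computes $f$ if this output equals $f(x,y)$ for all $(x,y)$. Its cost is its depth, the maximum number of edges on a root-to-leaf path. $C^{\mathrm{comp}}(f)$ is the minimum cost of a comparison protocol computing $f$. -}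

module Defs where

open import Data.Bool using (Bool; true; false)
open import Data.Nat using (ℕ; zero; suc; _+_; _*_; _^_; _≤_; _⊔_)
open import Data.Fin using (Fin)
open import Data.Vec using (Vec; []; _∷_)
open import Data.Product using (Σ; _×_; ∃)
open import Relation.Binary.PropositionalEquality using (_≡_; _≢_)
open import Relation.Nullary using (¬_; Dec; yes; no)

-- {0,1}^n as bit vectors, first bit most significant
BitStr : ℕ → Set
BitStr n = Vec Bool n

bitVal : Bool → ℕ
bitVal false = 0
bitVal true  = 1

val : ∀ {n} → BitStr n → ℕ
val {zero}  []       = 0
val {suc n} (b ∷ bs) = bitVal b * 2 ^ n + val bs

_≤lex_ : ∀ {n} → BitStr n → BitStr n → Set
x ≤lex y = val x ≤ val y

_∈[_,_] : ∀ {n} → BitStr n → BitStr n → BitStr n → Set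
z ∈[ a , b ] = (a ≤lex z) × (z ≤lex b)

record GeomRect (n : ℕ) : Set where
  constructor geomRect
  field
    amin amax bmin bmax : BitStr n

InRect : ∀ {n} → GeomRect n → BitStr n → BitStr n → Set
InRect R x y = (x ∈[ GeomRect.amin R , GeomRect.amax R ]) × (y ∈[ GeomRect.bmin R , GeomRect.bmax R ])

Monochromatic : ∀ {n} → (BitStr n → BitStr n → Bool) → GeomRect n → Set
Monochromatic f R = Σ Bool λ c → ∀ x y → InRect R x y → f x y ≡ c

IsMonoGeomPartition : ∀ {n} → (BitStr n → BitStr n → Bool) → (k : ℕ) → (Fin k → GeomRect n) → Set
IsMonoGeomPartition {n} f k R =
  (∀ i → Monochromatic f (R i)) ×
  (∀ i j → i ≢ j → ∀ (x y : BitStr n) → ¬ (InRect (R i) x y × InRect (R j) x y)) ×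
  (∀ (x y : BitStr n) → Σ (Fin k) λ i → InRect (R i) x y)

decBool : ∀ {P : Set} → Dec P → Bool
decBool (yes _) = true
decBool (no _)  = false

θ : ∀ {n} → BitStr n → BitStr n → Bool
θ z y = decBool (val z Data.Nat.≤? val y)

data Owner : Set where
  alice bob : Owner

data Query (n : ℕ) : Set where
  cmp   : BitStr n → Query n
  const0 : Query n

evalQuery : ∀ {n} → Query n → BitStr n → Bool
evalQuery (cmp z) v = θ z v
evalQuery const0  v = false

data Protocol (n : ℕ) : Set where
  leaf : Bool → Protocol n
  node : Owner → Query n → Protocol n → Protocol n → Protocol n

run : ∀ {n} → Protocol n → BitStr n → BitStr n → Bool
run (leaf b) x y = b
run (node o q p0 p1) x y with evalQuery q (input o)
  where
    input : Owner → BitStr _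
    input alice = x
    input bob   = y
... | false = run p0 x y
... | true  = run p1 x y

depth : ∀ {n} → Protocol n → ℕ
depth (leaf _) = 0
depth (node _ _ p0 p1) = suc (depth p0 ⊔ depth p1)

Computes : ∀ {n} → Protocol n → (BitStr n → BitStr n → Bool) → Set
Computes P f = ∀ x y → run P x y ≡ f x y

{-# OPTIONS --safe #-}
module Submission where

-- Every leaf of a comparison protocol is reached by the inputs of a product of
-- two intervals: each θ_z-query cuts the current interval of its owner at z, and a
-- constant query cuts nothing.  The at most 2^depth leaves therefore give a
-- partition of {0,1}^n × {0,1}^n into geometric rectangles, monochromatic because
-- the output only depends on the leaf.  Empty leaf rectangles are harmless, but
-- must be written as [a,b] with a > b, which needs n ≥ 1.

open import Defs
open import Data.Bool using (Bool; true; false; if_then_else_)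
open import Data.Nat using (ℕ; zero; suc; pred; _+_; _*_; _∸_; _^_; _≤_; _<_; _⊔_; _⊓_;
  z≤n; s≤s; s≤s⁻¹; _≤?_; _<?_)
open import Data.Nat.Properties
open import Data.Fin using (Fin; zero; splitAt; _↑ˡ_; _↑ʳ_)
open import Data.Fin.Properties using (splitAt-↑ˡ; splitAt-↑ʳ; splitAt⁻¹-↑ˡ; splitAt⁻¹-↑ʳ)
open import Data.Vec using ([]; _∷_)
open import Data.Sum using (inj₁; inj₂; [_,_]′)
open import Data.Product using (Σ; _×_; _,_; proj₁; proj₂; map₁; map₂)
open import Data.Product.Function.NonDependent.Propositional using (_×-⇔_)
open import Function using (_∘_; _⇔_; mk⇔; Equivalence)
open import Relation.Nullary using (¬_; yes; no; contradiction; Reflects; ofʸ; ofⁿ)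
open import Relation.Nullary.Reflects using (det)
open import Relation.Binary.PropositionalEquality using (_≡_; _≢_; refl; sym; trans; cong; cong₂; subst; module ≡-Reasoning)

private
  variable
    n m z : ℕ

toBits : ℕ → BitStr n
toBits {zero}  m = []
toBits {suc n} m with 2 ^ n ≤? m
... | yes _ = true  ∷ toBits (m ∸ 2 ^ n)
... | no _  = false ∷ toBits m

val-toBits : ∀ n {m} → m < 2 ^ n → val (toBits {n} m) ≡ m
val-toBits zero    {zero}  _         = refl
val-toBits zero    {suc m} (s≤s ())
val-toBits (suc n) {m} m<2^1+n with 2 ^ n ≤? m
... | no 2^n≰m = val-toBits n (≰⇒> 2^n≰m)
... | yes 2^n≤m = begin
  1 * 2 ^ n + val (toBits {n} (m ∸ 2 ^ n)) ≡⟨ cong₂ _+_ (*-identityˡ (2 ^ n)) (val-toBits n m∸2^n<2^n) ⟩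
  2 ^ n + (m ∸ 2 ^ n)                      ≡⟨ m+[n∸m]≡n 2^n≤m ⟩
  m                                        ∎
  where
  open ≡-Reasoning
  m∸2^n<2^n : m ∸ 2 ^ n < 2 ^ n
  m∸2^n<2^n = m<n+o⇒m∸n<o m (2 ^ n) {{m^n≢0 2 n}}
    (subst (m <_) (cong (2 ^ n +_) (+-identityʳ (2 ^ n))) m<2^1+n)

val<2^n : (x : BitStr n) → val x < 2 ^ n
val<2^n {zero}  []           = s≤s z≤n
val<2^n {suc n} (false ∷ xs) = ≤-trans (val<2^n xs) (m≤m+n (2 ^ n) _)
val<2^n {suc n} (true ∷ xs)  = subst (λ k → k + val xs < 2 ^ suc n) (sym (*-identityˡ (2 ^ n)))
  (+-monoʳ-< (2 ^ n) (≤-trans (val<2^n xs) (m≤m+n (2 ^ n) 0)))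

θ-reflects : (z v : BitStr n) → Reflects (val z ≤ val v) (θ z v)
θ-reflects z v with val z ≤? val v
... | yes z≤v = ofʸ z≤v
... | no z≰v  = ofⁿ z≰v

θ-true : (z v : BitStr n) → val z ≤ val v → θ z v ≡ true
θ-true z v z≤v = det (θ-reflects z v) (ofʸ z≤v)

θ-false : (z v : BitStr n) → val v < val z → θ z v ≡ false
θ-false z v v<z = det (θ-reflects z v) (ofⁿ (<⇒≱ v<z))

record Interval : Set where
  constructor [_,_⟩
  field
    lo hi : ℕ
open Interval

_∈ᵢ_ : ℕ → Interval → Set
m ∈ᵢ I = lo I ≤ m × m < hi I

below above : ℕ → Interval → Interval
below z I = [ lo I , hi I ⊓ z ⟩
above z I = [ lo I ⊔ z , hi I ⟩

∈-below⁺ : ∀ {I} → m ∈ᵢ I → m < z → m ∈ᵢ below z I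
∈-below⁺ (lo≤m , m<hi) m<z = lo≤m , ⊓-pres-m< m<hi m<z

∈-below⁻ : ∀ {I} → m ∈ᵢ below z I → m ∈ᵢ I × m < z
∈-below⁻ (lo≤m , m<hi⊓z) = (lo≤m , m<n⊓o⇒m<n _ _ m<hi⊓z) , m<n⊓o⇒m<o _ _ m<hi⊓z

∈-above⁺ : ∀ {I} → m ∈ᵢ I → z ≤ m → m ∈ᵢ above z I
∈-above⁺ (lo≤m , m<hi) z≤m = ⊔-lub lo≤m z≤m , m<hi

∈-above⁻ : ∀ {I} → m ∈ᵢ above z I → m ∈ᵢ I × z ≤ m
∈-above⁻ (lo⊔z≤m , m<hi) = (m⊔n≤o⇒m≤o _ _ lo⊔z≤m , m<hi) , m⊔n≤o⇒n≤o _ _ lo⊔z≤m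

Rect : Set
Rect = Interval × Interval

ValInRect : Rect → BitStr n → BitStr n → Set
ValInRect (I , J) x y = val x ∈ᵢ I × val y ∈ᵢ J

input : Owner → BitStr n → BitStr n → BitStr n
input alice x y = x
input bob   x y = y

refine : Owner → (Interval → Interval) → Rect → Rect
refine alice g (I , J) = g I , J
refine bob   g (I , J) = I , g J

module _ {g : Interval → Interval} {Q : ℕ → Set} where

  ∈-refine⁺ : (∀ {I m} → m ∈ᵢ I → Q m → m ∈ᵢ g I) →
    ∀ o R (x y : BitStr n) → ValInRect R x y → Q (val (input o x y)) → ValInRect (refine o g R) x y
  ∈-refine⁺ g⁺ alice R x y (x∈ , y∈) q = g⁺ x∈ q , y∈
  ∈-refine⁺ g⁺ bob   R x y (x∈ , y∈) q = x∈ , g⁺ y∈ q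

  ∈-refine⁻ : (∀ {I m} → m ∈ᵢ g I → m ∈ᵢ I × Q m) →
    ∀ o R (x y : BitStr n) → ValInRect (refine o g R) x y → ValInRect R x y × Q (val (input o x y))
  ∈-refine⁻ g⁻ alice R x y (x∈ , y∈) = map₁ (_, y∈) (g⁻ x∈)
  ∈-refine⁻ g⁻ bob   R x y (x∈ , y∈) = map₁ (x∈ ,_) (g⁻ y∈)

run-node : ∀ o q (p₀ p₁ : Protocol n) x y →
  run (node o q p₀ p₁) x y ≡ (if evalQuery q (input o x y) then run p₁ x y else run p₀ x y)
run-node alice q p₀ p₁ x y with evalQuery q x
... | false = refl
... | true  = refl
run-node bob   q p₀ p₁ x y with evalQuery q y
... | false = refl
... | true  = refl

-- A const0-node always answers 0, so its 1-subtree is unreachable and gets no leaves.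
leafCount : Protocol n → ℕ
leafCount (leaf _)               = 1
leafCount (node _ const0  p₀ _)  = leafCount p₀
leafCount (node _ (cmp _) p₀ p₁) = leafCount p₀ + leafCount p₁

leafIndex : (P : Protocol n) → BitStr n → BitStr n → Fin (leafCount P)
leafIndex (leaf _)               x y = zero
leafIndex (node _ const0  p₀ _)  x y = leafIndex p₀ x y
leafIndex (node o (cmp z) p₀ p₁) x y =
  if θ z (input o x y) then leafCount p₀ ↑ʳ leafIndex p₁ x y else leafIndex p₀ x y ↑ˡ leafCount p₁

leafLabel : (P : Protocol n) → Fin (leafCount P) → Bool
leafLabel (leaf b)               _ = b
leafLabel (node _ const0  p₀ _)  i = leafLabel p₀ i
leafLabel (node _ (cmp _) p₀ p₁) i = [ leafLabel p₀ , leafLabel p₁ ]′ (splitAt (leafCount p₀) i)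

leafRect : (P : Protocol n) → Rect → Fin (leafCount P) → Rect
leafRect (leaf _)               R _ = R
leafRect (node _ const0  p₀ _)  R i = leafRect p₀ R i
leafRect (node o (cmp z) p₀ p₁) R i =
  [ leafRect p₀ (refine o (below (val z)) R) , leafRect p₁ (refine o (above (val z)) R) ]′
    (splitAt (leafCount p₀) i)

run≡leafLabel : ∀ (P : Protocol n) x y → run P x y ≡ leafLabel P (leafIndex P x y)
run≡leafLabel (leaf _)               x y = refl
run≡leafLabel (node o const0  p₀ p₁) x y = run≡leafLabel p₀ x y
run≡leafLabel (node o (cmp z) p₀ p₁) x y rewrite run-node o (cmp z) p₀ p₁ x y
  with θ z (input o x y)
... | false rewrite splitAt-↑ˡ (leafCount p₀) (leafIndex p₀ x y) (leafCount p₁) = run≡leafLabel p₀ x y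
... | true  rewrite splitAt-↑ʳ (leafCount p₀) (leafCount p₁) (leafIndex p₁ x y) = run≡leafLabel p₁ x y

∈-leafRect⁺ : ∀ (P : Protocol n) R x y → ValInRect R x y → ValInRect (leafRect P R (leafIndex P x y)) x y
∈-leafRect⁺ (leaf _)               R x y xy∈R = xy∈R
∈-leafRect⁺ (node _ const0  p₀ _)  R x y xy∈R = ∈-leafRect⁺ p₀ R x y xy∈R
∈-leafRect⁺ (node o (cmp z) p₀ p₁) R x y xy∈R with θ z (input o x y) | θ-reflects z (input o x y)
... | true  | ofʸ z≤v rewrite splitAt-↑ʳ (leafCount p₀) (leafCount p₁) (leafIndex p₁ x y) =
  ∈-leafRect⁺ p₁ _ x y (∈-refine⁺ ∈-above⁺ o R x y xy∈R z≤v)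
... | false | ofⁿ z≰v rewrite splitAt-↑ˡ (leafCount p₀) (leafIndex p₀ x y) (leafCount p₁) =
  ∈-leafRect⁺ p₀ _ x y (∈-refine⁺ ∈-below⁺ o R x y xy∈R (≰⇒> z≰v))

∈-leafRect⁻ : ∀ (P : Protocol n) R i x y → ValInRect (leafRect P R i) x y →
  ValInRect R x y × leafIndex P x y ≡ i
∈-leafRect⁻ (leaf _)               R zero x y xy∈ = xy∈ , refl
∈-leafRect⁻ (node _ const0  p₀ _)  R i    x y xy∈ = ∈-leafRect⁻ p₀ R i x y xy∈
∈-leafRect⁻ (node o (cmp z) p₀ p₁) R i    x y xy∈ with splitAt (leafCount p₀) i in split≡
... | inj₁ j with ∈-leafRect⁻ p₀ _ j x y xy∈
...   | xy∈R₀ , index≡j with ∈-refine⁻ ∈-below⁻ o R x y xy∈R₀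
...     | xy∈R , v<z rewrite θ-false z (input o x y) v<z =
  xy∈R , trans (cong (_↑ˡ leafCount p₁) index≡j) (splitAt⁻¹-↑ˡ split≡)
∈-leafRect⁻ (node o (cmp z) p₀ p₁) R i x y xy∈ | inj₂ j with ∈-leafRect⁻ p₁ _ j x y xy∈
...   | xy∈R₁ , index≡j with ∈-refine⁻ ∈-above⁻ o R x y xy∈R₁
...     | xy∈R , z≤v rewrite θ-true z (input o x y) z≤v =
  xy∈R , trans (cong (leafCount p₀ ↑ʳ_) index≡j) (splitAt⁻¹-↑ʳ split≡)

leafCount≤2^depth : (P : Protocol n) → leafCount P ≤ 2 ^ depth P
leafCount≤2^depth (leaf _) = ≤-refl
leafCount≤2^depth (node _ const0 p₀ p₁) = begin
  leafCount p₀                          ≤⟨ leafCount≤2^depth p₀ ⟩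
  2 ^ depth p₀                          ≤⟨ ^-monoʳ-≤ 2 (m≤m⊔n (depth p₀) (depth p₁)) ⟩
  2 ^ (depth p₀ ⊔ depth p₁)             ≤⟨ m≤m+n _ _ ⟩
  2 ^ suc (depth p₀ ⊔ depth p₁)         ∎
  where open ≤-Reasoning
leafCount≤2^depth (node _ (cmp _) p₀ p₁) = begin
  leafCount p₀ + leafCount p₁           ≤⟨ +-mono-≤ (leafCount≤2^depth p₀) (leafCount≤2^depth p₁) ⟩
  2 ^ depth p₀ + 2 ^ depth p₁           ≤⟨ +-mono-≤ (^-monoʳ-≤ 2 (m≤m⊔n (depth p₀) (depth p₁)))
                                                     (^-monoʳ-≤ 2 (m≤n⊔m (depth p₀) (depth p₁))) ⟩
  2 ^ d + 2 ^ d                         ≡⟨ cong (2 ^ d +_) (sym (+-identityʳ (2 ^ d))) ⟩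
  2 ^ suc d                             ∎
  where
  open ≤-Reasoning
  d : ℕ
  d = depth p₀ ⊔ depth p₁

-- Clamping at 2 ^ n makes the translation exact for every interval (∈-bitBounds),
-- so the leaf rectangles need no bound invariant.
bitBounds : Interval → BitStr n × BitStr n
bitBounds {n} [ lo , hi ⟩ with lo <? hi ⊓ 2 ^ n
... | yes _ = toBits lo , toBits (pred (hi ⊓ 2 ^ n))
... | no _  = toBits 1 , toBits 0

toGeomRect : Rect → GeomRect n
toGeomRect (I , J) =
  geomRect (proj₁ (bitBounds I)) (proj₂ (bitBounds I)) (proj₁ (bitBounds J)) (proj₂ (bitBounds J))

∈-toBits-pred : ∀ {lo h} → lo < h → h ≤ 2 ^ n → (v : BitStr n) →
  (v ∈[ toBits lo , toBits (pred h) ]) ⇔ (lo ≤ val v × val v < h)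
∈-toBits-pred {n} {lo} {suc h} lo<1+h 1+h≤2^n v
  rewrite val-toBits n (<-≤-trans lo<1+h 1+h≤2^n) | val-toBits n 1+h≤2^n = mk⇔ (map₂ s≤s) (map₂ s≤s⁻¹)

∈-bitBounds : 1 ≤ n → ∀ I (v : BitStr n) → (v ∈[ proj₁ (bitBounds I) , proj₂ (bitBounds I) ]) ⇔ val v ∈ᵢ I
∈-bitBounds {n} 1≤n [ lo , hi ⟩ v with lo <? hi ⊓ 2 ^ n
... | yes lo<h =
  mk⇔ (map₂ (m<n⊓o⇒m<n hi (2 ^ n)) ∘ Equivalence.to clamped)
      (Equivalence.from clamped ∘ map₂ (λ v<hi → ⊓-pres-m< v<hi (val<2^n v)))
  where
  clamped : (v ∈[ toBits lo , toBits (pred (hi ⊓ 2 ^ n)) ]) ⇔ (lo ≤ val v × val v < hi ⊓ 2 ^ n)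
  clamped = ∈-toBits-pred lo<h (m⊓n≤n hi (2 ^ n)) v
... | no lo≮h
  rewrite val-toBits n {1} (^-monoʳ-≤ 2 1≤n) | val-toBits n {0} (m^n>0 2 n) =
  mk⇔ (λ (1≤v , v≤0) → contradiction (≤-trans 1≤v v≤0) λ ())
      (λ (lo≤v , v<hi) → contradiction (≤-<-trans lo≤v (⊓-pres-m< v<hi (val<2^n v))) lo≮h)

∈-toGeomRect : 1 ≤ n → ∀ R (x y : BitStr n) → InRect (toGeomRect R) x y ⇔ ValInRect R x y
∈-toGeomRect 1≤n (I , J) x y = ∈-bitBounds 1≤n I x ×-⇔ ∈-bitBounds 1≤n J y

mainTheorem5 : (n : ℕ) → 1 ≤ n → (f : BitStr n → BitStr n → Bool) →
    (P : Protocol n) → Computes P f →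
    Σ ℕ λ k → Σ (Fin k → GeomRect n) λ R →
      IsMonoGeomPartition f k R × (k ≤ 2 ^ depth P)
mainTheorem5 n 1≤n f P P-computes-f =
  leafCount P , rect , (monochromatic , disjoint , covering) , leafCount≤2^depth P
  where
  everything : Rect
  everything = [ 0 , 2 ^ n ⟩ , [ 0 , 2 ^ n ⟩

  rect : Fin (leafCount P) → GeomRect n
  rect = toGeomRect ∘ leafRect P everything

  reaches : ∀ {i} x y → InRect (rect i) x y → leafIndex P x y ≡ i
  reaches {i} x y = proj₂ ∘ ∈-leafRect⁻ P everything i x y ∘ Equivalence.to (∈-toGeomRect 1≤n _ x y)

  monochromatic : ∀ i → Monochromatic f (rect i)
  monochromatic i = leafLabel P i , λ x y xy∈ →
    trans (sym (P-computes-f x y)) (trans (run≡leafLabel P x y) (cong (leafLabel P) (reaches x y xy∈)))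

  disjoint : ∀ i j → i ≢ j → ∀ x y → ¬ (InRect (rect i) x y × InRect (rect j) x y)
  disjoint i j i≢j x y (xy∈i , xy∈j) = i≢j (trans (sym (reaches x y xy∈i)) (reaches x y xy∈j))

  covering : ∀ x y → Σ (Fin (leafCount P)) λ i → InRect (rect i) x y
  covering x y = leafIndex P x y , Equivalence.from (∈-toGeomRect 1≤n _ x y)
    (∈-leafRect⁺ P everything x y ((z≤n , val<2^n x) , (z≤n , val<2^n y)))
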